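{- If the equation $\sum_{i=1}^{m}x_i^{n}=bc^n$ is standard, then for $0\leq b<m$ it has no natural solutions. In particular, if the equation $\sum_{i=1}^{m}x_i^{n}=c^n$ is standard, then it has no natural solutions.
   Context: Let $n,m\geq 2$ be natural numbers, $b$ a nonnegative integer and $c\in\mathbb{N}$. A natural solution of an equation $f(x_1,\ldots,x_m)=0$ is a solution $(x_1,\ldots,x_m)$ with all $x_i\in\mathbb{N}$ (positive integers). For an even natural number $n$, a prime $p$ is called a $\varphi$-divisor of $n$ if there is a natural number $k$ with $\varphi(p^k)\mid n$ and $p^k\geq 3$, where $\varphi$ is Euler's totient function; the largest such $k$ is called the degree of this $\varphi$-divisor. The equation $\sum_{i=1}^{m}x_i^{n}=bc^n$ is called standard if $n$ is even, $c=p_1^{n_1}p_2^{n_2}\cdots p_l^{n_l}$ with natural exponents $n_1,\ldots,n_l$, where each prime $p_i$ is a $\varphi$-divisor of degree $k_i$ of $n$ (with $p_i^{k_i}\geq 3$), $i=1,\ldots,l$, and $2\leq m\leq \min(p_1^{k_1}-1,p_2^{k_2}-1,\ldots,p_l^{k_l}-1)$. -}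

module Defs where

open import Data.Nat using (ℕ; zero; suc; _+_; _*_; _^_; _≤_; _<_)
open import Data.Nat.Divisibility using (_∣_)
open import Data.Nat.GCD using (gcd)
open import Data.Nat.Primality using (Prime)
open import Data.List using (List; []; _∷_; map; filter; length; foldr; upTo)
open import Data.List.Relation.Unary.All using (All)
open import Data.List.Relation.Unary.Unique.Propositional using (Unique)
open import Data.Product using (_×_; _,_; proj₁; proj₂; ∃)
open import Data.Fin using (Fin)
import Data.Fin as Fin
open import Data.Nat using (_≟_)
open import Relation.Binary.PropositionalEquality using (_≡_)
open import Relation.Nullary using (¬_)

φ : ℕ → ℕ
φ n = length (filter (λ i → gcd (suc i) n ≟ 1) (upTo n))

Even : ℕ → Set
Even n = 2 ∣ n

φDivWitness : ℕ → ℕ → ℕ → Set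
φDivWitness n p k = (1 ≤ k) × (φ (p ^ k) ∣ n) × (3 ≤ p ^ k)

IsφDivisorOfDegree : ℕ → ℕ → ℕ → Set
IsφDivisorOfDegree n p k =
  Prime p × φDivWitness n p k × (∀ j → φDivWitness n p j → j ≤ k)

sumPow : ∀ {m} → (Fin m → ℕ) → ℕ → ℕ
sumPow {zero} x n = 0
sumPow {suc m} x n = x Fin.zero ^ n + sumPow (λ i → x (Fin.suc i)) n

-- A factorization: list of (prime, exponent) pairs; its value
factValue : List (ℕ × ℕ) → ℕ
factValue = foldr (λ pe acc → proj₁ pe ^ proj₂ pe * acc) 1

Standard : (m n b c : ℕ) → Set
Standard m n b c =
  Even n × 2 ≤ m ×
  ∃ λ (fs : List (ℕ × ℕ)) →
    ¬ (fs ≡ []) ×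
    Unique (map proj₁ fs) ×
    c ≡ factValue fs ×
    All (λ pe → 1 ≤ proj₂ pe ×
                ∃ λ k → IsφDivisorOfDegree n (proj₁ pe) k × suc m ≤ proj₁ pe ^ k) fs

module Submission where

-- Let p be one of the primes of c, a φ-divisor of n of degree k with m < p^k.
-- Maximality of k forces n ≠ 0, so n ≥ φ(p^k) ≥ k; hence x^n ≡ 0 (mod p^k)
-- when p ∣ x, while Euler's theorem gives x^n ≡ 1 (mod p^k) when p ∤ x.
-- The left-hand side is therefore congruent modulo p^k to the number of x_i
-- prime to p, a number in [0, m] with m < p^k, whereas the right-hand side
-- is divisible by p^k.  So p divides every x_i, and p^n cancels from the
-- equation.  Stripping all primes of c this way leaves Σ x_i^n = b, which is
-- impossible because Σ x_i^n ≥ m > b.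

open import Data.Nat
open import Data.Nat.Properties
open import Data.Nat.Divisibility
open import Data.Nat.Primality using (Prime; euclidsLemma; prime⇒irreducible; prime⇒nonZero; prime⇒nonTrivial)
open import Data.Nat.Coprimality using (Coprime; coprime⇒gcd≡1; coprime-divisor)
open import Data.Nat.GCD using (gcd; gcd-greatest)
open import Data.Nat.Combinatorics using (_C_; nCn≡1; nC1≡n; nCk+nC[k+1]≡[n+1]C[k+1]; k>n⇒nCk≡0)
open import Data.Nat.Solver using (module +-*-Solver)
open import Data.Fin using (Fin; zero; suc; toℕ; inject₁; fromℕ)
open import Data.Fin.Properties using (toℕ-inject₁; toℕ<n; toℕ-fromℕ)
open import Data.Vec using (count; tabulate)
open import Data.Vec.Properties using (count≤n)
open import Data.List using ([]; _∷_; [_]; _++_; _∷ʳ_; length; filter; applyUpTo; upTo)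
open import Data.List.Properties using (applyUpTo-∷ʳ; filter-++; filter-all; filter-reject; filter-≐; length-++; length-applyUpTo; ++-identityʳ)
open import Data.List.Relation.Unary.All using (All; []; _∷_)
import Data.List.Relation.Unary.All as All
open import Data.List.Relation.Unary.All.Properties using (applyUpTo⁺₁)
open import Data.Product using (∃; _×_; _,_; proj₁; proj₂)
open import Data.Sum using (inj₁; inj₂)
open import Data.Empty using (⊥; ⊥-elim)
open import Function using (_∘_; id)
open import Relation.Nullary using (Dec; ¬?; yes; no)
open import Relation.Binary.PropositionalEquality hiding ([_])
import Algebra.Properties.CommutativeSemiring.Binomial +-*-commutativeSemiring as Binomial
import Algebra.Properties.CommutativeSemiring.Exp +-*-commutativeSemiring as Exp
import Algebra.Properties.Semiring.Mult +-*-semiring as Mult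
import Algebra.Properties.Semiring.Sum +-*-semiring as Sum

open import Defs

open +-*-Solver using (solve; _:+_; _:*_; _:=_; con)

-- The library's binomial theorem is stated with the generic semiring power
-- and ℕ-scaling; on ℕ these agree with _^_ and _*_.
semiring-^≡^ : ∀ x n → x Exp.^ n ≡ x ^ n
semiring-^≡^ x zero    = refl
semiring-^≡^ x (suc n) = cong (x *_) (semiring-^≡^ x n)

semiring-×≡* : ∀ n x → n Mult.× x ≡ n * x
semiring-×≡* zero    x = refl
semiring-×≡* (suc n) x = cong (x +_) (semiring-×≡* n x)

^-distrib-* : ∀ x y n → (x * y) ^ n ≡ x ^ n * y ^ n
^-distrib-* x y n = begin
  (x * y) ^ n            ≡⟨ semiring-^≡^ (x * y) n ⟨
  (x * y) Exp.^ n        ≡⟨ Exp.^-distrib-* x y n ⟩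
  x Exp.^ n * y Exp.^ n  ≡⟨ cong₂ _*_ (semiring-^≡^ x n) (semiring-^≡^ y n) ⟩
  x ^ n * y ^ n          ∎
  where open ≡-Reasoning

^-monoˡ-∣ : ∀ {a b} n → a ∣ b → a ^ n ∣ b ^ n
^-monoˡ-∣ zero    a∣b = ∣-refl
^-monoˡ-∣ (suc n) a∣b = *-pres-∣ a∣b (^-monoˡ-∣ n a∣b)

^-monoʳ-∣ : ∀ a {k n} → k ≤ n → a ^ k ∣ a ^ n
^-monoʳ-∣ a {k} k≤n =
  subst (a ^ k ∣_) (trans (sym (^-distribˡ-+-* a k _)) (cong (a ^_) (m+[n∸m]≡n k≤n))) (m∣m*n _)

n<[1+m]^n : ∀ {m} → 0 < m → ∀ n → n < suc m ^ n
n<[1+m]^n 0<m zero    = z<s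
n<[1+m]^n {m} 0<m (suc n) = subst (_≤ suc m ^ suc n) (+-comm (suc n) 1)
  (+-mono-≤ (n<[1+m]^n 0<m n) (*-mono-≤ 0<m (m^n>0 (suc m) n)))

<∧∣⇒≡0 : ∀ {m n} → m < n → n ∣ m → m ≡ 0
<∧∣⇒≡0 {zero}  _   _   = refl
<∧∣⇒≡0 {suc m} m<n n∣m = ⊥-elim (>⇒∤ m<n n∣m)

∣-sum : ∀ {d n} (t : Fin n → ℕ) → (∀ i → d ∣ t i) → d ∣ Sum.sum t
∣-sum {n = zero}  t d∣t = _ ∣0
∣-sum {n = suc n} t d∣t = ∣m∣n⇒∣m+n (d∣t zero) (∣-sum (t ∘ suc) (d∣t ∘ suc))

_∤?_ : ∀ p x → Dec (p ∤ x)
p ∤? x = ¬? (p ∣? x)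

-- Fermat's and Euler's theorems

[1+k]*[1+n]C[1+k]≡[1+n]*nCk : ∀ n k → suc k * (suc n C suc k) ≡ suc n * (n C k)
[1+k]*[1+n]C[1+k]≡[1+n]*nCk zero    zero    = refl
[1+k]*[1+n]C[1+k]≡[1+n]*nCk zero    (suc k) =
  trans (cong (suc (suc k) *_) (k>n⇒nCk≡0 {1} {2 + k} (s≤s (s≤s z≤n)))) (*-zeroʳ (suc (suc k)))
[1+k]*[1+n]C[1+k]≡[1+n]*nCk (suc n) zero    =
  trans (+-identityʳ _) (trans (nC1≡n (suc (suc n))) (sym (*-identityʳ (suc (suc n)))))
[1+k]*[1+n]C[1+k]≡[1+n]*nCk (suc n) (suc k) = begin
    suc (suc k) * (suc (suc n) C suc (suc k))
  ≡⟨ cong (suc (suc k) *_) (nCk+nC[k+1]≡[n+1]C[k+1] (suc n) (suc k)) ⟨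
    suc (suc k) * (a + b)
  ≡⟨ solve 3 (λ k a b → (con 1 :+ k) :* (a :+ b) := a :+ k :* a :+ (con 1 :+ k) :* b) refl (suc k) a b ⟩
    a + suc k * a + suc (suc k) * b
  ≡⟨ cong₂ (λ u v → a + u + v) ([1+k]*[1+n]C[1+k]≡[1+n]*nCk n k) ([1+k]*[1+n]C[1+k]≡[1+n]*nCk n (suc k)) ⟩
    a + suc n * (n C k) + suc n * (n C suc k)
  ≡⟨ solve 4 (λ n a c d → a :+ n :* c :+ n :* d := a :+ n :* (c :+ d)) refl (suc n) a (n C k) (n C suc k) ⟩
    a + suc n * (n C k + n C suc k)
  ≡⟨ cong (λ u → a + suc n * u) (nCk+nC[k+1]≡[n+1]C[k+1] n k) ⟩
    suc (suc n) * a
  ∎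
  where
  open ≡-Reasoning
  a = suc n C suc k
  b = suc n C suc (suc k)

prime∣pCk : ∀ {p k} → Prime p → 0 < k → k < p → p ∣ p C k
prime∣pCk {suc r} {suc k} pr _ k<p
  with euclidsLemma (suc k) (suc r C suc k) pr
         (divides (r C k) (trans ([1+k]*[1+n]C[1+k]≡[1+n]*nCk r k) (*-comm (suc r) (r C k))))
... | inj₁ p∣1+k = ⊥-elim (<⇒≱ k<p (∣⇒≤ p∣1+k))
... | inj₂ p∣pCk = p∣pCk

freshmans-dream : ∀ {p} → Prime p → ∀ x → ∃ λ t → (x + 1) ^ p ≡ 1 + x ^ p + t * p
freshmans-dream {suc r} pr x = s , (begin
    (x + 1) ^ p
  ≡⟨ semiring-^≡^ (x + 1) p ⟨
    (x + 1) Exp.^ p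
  ≡⟨ Binomial.theorem p x 1 ⟩
    term zero + Sum.sum (term ∘ suc)
  ≡⟨ cong (term zero +_) (Sum.sum-init-last (term ∘ suc)) ⟩
    term zero + (Sum.sum middle + term (fromℕ p))
  ≡⟨ cong₂ (λ u v → u + (v + term (fromℕ p))) first≡1 middle≡s*p ⟩
    1 + (s * p + term (fromℕ p))
  ≡⟨ cong (λ u → 1 + (s * p + u)) last≡x^p ⟩
    1 + (s * p + x ^ p)
  ≡⟨ cong suc (+-comm (s * p) (x ^ p)) ⟩
    1 + x ^ p + s * p
  ∎)
  where
  open ≡-Reasoning
  p = suc r
  term : Fin (suc p) → ℕ
  term = Binomial.binomialTerm x 1 p
  middle : Fin r → ℕ
  middle i = term (suc (inject₁ i))
  p∣middle : ∀ i → p ∣ middle i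
  p∣middle i = subst (p ∣_) (sym (semiring-×≡* (p C toℕ k) (Binomial.binomial x 1 p k)))
    (∣m⇒∣m*n (Binomial.binomial x 1 p k) (prime∣pCk pr z<s (s<s (subst (_< r) (sym (toℕ-inject₁ i)) (toℕ<n i)))))
    where k = suc (inject₁ i)
  open _∣_ (∣-sum middle p∣middle) renaming (quotient to s; equality to middle≡s*p)
  first≡1 : term zero ≡ 1
  first≡1 = trans (+-identityʳ _) (trans (*-identityˡ _) (trans (semiring-^≡^ 1 p) (^-zeroˡ p)))
  last≡x^p : term (fromℕ p) ≡ x ^ p
  last≡x^p = begin
      term (fromℕ p)
    ≡⟨ semiring-×≡* (p C toℕ (fromℕ p)) (Binomial.binomial x 1 p (fromℕ p)) ⟩
      (p C toℕ (fromℕ p)) * (x Exp.^ toℕ (fromℕ p) * 1 Exp.^ (p ∸ toℕ (fromℕ p)))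
    ≡⟨ cong (λ j → (p C j) * (x Exp.^ j * 1 Exp.^ (p ∸ j))) (toℕ-fromℕ p) ⟩
      (p C p) * (x Exp.^ p * 1 Exp.^ (p ∸ p))
    ≡⟨ cong₂ (λ c e → c * (x Exp.^ p * 1 Exp.^ e)) (nCn≡1 p) (n∸n≡0 p) ⟩
      1 * (x Exp.^ p * 1)
    ≡⟨ trans (*-identityˡ _) (trans (*-identityʳ _) (semiring-^≡^ x p)) ⟩
      x ^ p
    ∎

fermat : ∀ {p} → Prime p → ∀ x → ∃ λ t → x ^ p ≡ x + t * p
fermat {suc r} pr zero    = 0 , refl
fermat {p}     pr (suc x) =
  let t , x^p≡ = fermat pr x
      s , [x+1]^p≡ = freshmans-dream pr x
  in s + t , (begin
    suc x ^ p               ≡⟨ cong (_^ p) (+-comm 1 x) ⟩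
    (x + 1) ^ p             ≡⟨ [x+1]^p≡ ⟩
    1 + x ^ p + s * p       ≡⟨ cong (λ u → 1 + u + s * p) x^p≡ ⟩
    1 + (x + t * p) + s * p ≡⟨ solve 4 (λ x t s p → con 1 :+ (x :+ t :* p) :+ s :* p := con 1 :+ x :+ (s :+ t) :* p) refl x t s p ⟩
    suc x + (s + t) * p     ∎)
  where open ≡-Reasoning

infix 4 _≡1-mod_
_≡1-mod_ : ℕ → ℕ → Set
a ≡1-mod M = ∃ λ t → a ≡ 1 + t * M

cancel-nonMultiple : ∀ {p a t} b → Prime p → p ∤ a → 0 < b → a * b ≡ a + t * p → b ≡1-mod p
cancel-nonMultiple {a = a} {t} (suc u) pr p∤a _ ab≡a+tp
  with euclidsLemma a u pr (divides t (+-cancelˡ-≡ a _ _ (trans (sym (*-suc a u)) ab≡a+tp)))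
... | inj₁ p∣a            = ⊥-elim (p∤a p∣a)
... | inj₂ (divides s u≡) = s , cong suc u≡

fermat-≡1 : ∀ {r x} → Prime (suc r) → suc r ∤ x → x ^ r ≡1-mod suc r
fermat-≡1 {r} {zero}  pr p∤x = ⊥-elim (p∤x (suc r ∣0))
fermat-≡1 {r} {suc x} pr p∤x =
  let t , x^p≡x+tp = fermat pr (suc x)
  in cancel-nonMultiple {t = t} (suc x ^ r) pr p∤x (m^n>0 (suc x) r) x^p≡x+tp

≡1-mod-^ : ∀ {a M} → a ≡1-mod M → ∀ e → a ^ e ≡1-mod M
≡1-mod-^ _ zero = 0 , refl
≡1-mod-^ {a} {M} a≡1@(t , refl) (suc e) =
  let t′ , a^e≡ = ≡1-mod-^ a≡1 e
  in t + t′ + t * t′ * M , (begin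
    a * a ^ e                     ≡⟨ cong (a *_) a^e≡ ⟩
    (1 + t * M) * (1 + t′ * M)    ≡⟨ solve 3 (λ M t t′ → (con 1 :+ t :* M) :* (con 1 :+ t′ :* M) := con 1 :+ (t :+ t′ :+ t :* t′ :* M) :* M) refl M t t′ ⟩
    1 + (t + t′ + t * t′ * M) * M ∎)
  where open ≡-Reasoning

[1+d]^j≡1+j*d+d²s : ∀ d j → ∃ λ s → (1 + d) ^ j ≡ 1 + j * d + d * d * s
[1+d]^j≡1+j*d+d²s d zero    = 0 , solve 1 (λ d → con 1 := con 1 :+ con 0 :* d :+ d :* d :* con 0) refl d
[1+d]^j≡1+j*d+d²s d (suc j) =
  let s , [1+d]^j≡ = [1+d]^j≡1+j*d+d²s d j
  in s + j + d * s , (begin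
    (1 + d) * (1 + d) ^ j                   ≡⟨ cong ((1 + d) *_) [1+d]^j≡ ⟩
    (1 + d) * (1 + j * d + d * d * s)       ≡⟨ solve 3 (λ d j s → (con 1 :+ d) :* (con 1 :+ j :* d :+ d :* d :* s) := con 1 :+ (con 1 :+ j) :* d :+ d :* d :* (s :+ j :+ d :* s)) refl d j s ⟩
    1 + suc j * d + d * d * (s + j + d * s) ∎)
  where open ≡-Reasoning

≡1-mod-lift : ∀ {a M} p → a ≡1-mod M → p ∣ M → a ^ p ≡1-mod p * M
≡1-mod-lift {M = M} p (t , refl) (divides P M≡P*p) =
  let s , [1+tM]^p≡ = [1+d]^j≡1+j*d+d²s (t * M) p
  in t + t * t * P * s , (begin
    (1 + t * M) ^ p
  ≡⟨ [1+tM]^p≡ ⟩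
    1 + p * (t * M) + t * M * (t * M) * s
  ≡⟨ cong (λ m → 1 + p * (t * M) + t * M * (t * m) * s) M≡P*p ⟩
    1 + p * (t * M) + t * M * (t * (P * p)) * s
  ≡⟨ solve 5 (λ p P t s M → con 1 :+ p :* (t :* M) :+ t :* M :* (t :* (P :* p)) :* s := con 1 :+ (t :+ t :* t :* P :* s) :* (p :* M)) refl p P t s M ⟩
    1 + (t + t * t * P * s) * (p * M)
  ∎)
  where open ≡-Reasoning

euler-prime-power : ∀ {r x} → Prime (suc r) → suc r ∤ x → ∀ k → x ^ (suc r ^ k * r) ≡1-mod suc r ^ suc k
euler-prime-power {r} {x} pr p∤x zero =
  subst₂ _≡1-mod_ (cong (x ^_) (sym (+-identityʳ r))) (sym (*-identityʳ (suc r))) (fermat-≡1 pr p∤x)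
euler-prime-power {r} {x} pr p∤x (suc k) =
  subst (_≡1-mod suc r ^ suc (suc k)) x^[p^k*r]^p≡x^[p^[k+1]*r]
    (≡1-mod-lift (suc r) (euler-prime-power pr p∤x k) (m∣m*n (suc r ^ k)))
  where
  x^[p^k*r]^p≡x^[p^[k+1]*r] : (x ^ (suc r ^ k * r)) ^ suc r ≡ x ^ (suc r ^ suc k * r)
  x^[p^k*r]^p≡x^[p^[k+1]*r] = trans (^-*-assoc x (suc r ^ k * r) (suc r))
    (cong (x ^_) (solve 3 (λ a r p → a :* r :* p := p :* a :* r) refl (suc r ^ k) r (suc r)))

-- The totient of a prime power

applyUpTo-cong : ∀ {a} {A : Set a} {f g : ℕ → A} → f ≗ g → ∀ n → applyUpTo f n ≡ applyUpTo g n
applyUpTo-cong f≗g zero    = refl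
applyUpTo-cong f≗g (suc n) = cong₂ _∷_ (f≗g 0) (applyUpTo-cong (f≗g ∘ suc) n)

applyUpTo-++ : ∀ {a} {A : Set a} (f : ℕ → A) m n →
  applyUpTo f (m + n) ≡ applyUpTo f m ++ applyUpTo (λ i → f (m + i)) n
applyUpTo-++ f zero    n = refl
applyUpTo-++ f (suc m) n = cong (f 0 ∷_) (applyUpTo-++ (f ∘ suc) m n)

prime∤⇒coprime : ∀ {p a} → Prime p → p ∤ a → Coprime a p
prime∤⇒coprime pr p∤a (d∣a , d∣p) with prime⇒irreducible pr d∣p
... | inj₁ d≡1  = d≡1
... | inj₂ refl = ⊥-elim (p∤a d∣a)

coprime-^ : ∀ {a p} → Coprime a p → ∀ k → Coprime a (p ^ k)
coprime-^ a⊥p zero    (_ , d∣1)       = ∣1⇒≡1 d∣1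
coprime-^ a⊥p (suc k) (d∣a , d∣p^k+1) = coprime-^ a⊥p k (d∣a , coprime-divisor d⊥p d∣p^k+1)
  where
  d⊥p : Coprime _ _
  d⊥p (e∣d , e∣p) = a⊥p (∣-trans e∣d d∣a , e∣p)

module _ {r} (pr : Prime (suc r)) where

  private
    p = suc r

    nonMultiple? = λ i → p ∤? suc i

  -- applyUpTo (o +_) n lists o, …, o + n − 1, standing for o + 1, …, o + n, since φ tests gcd (suc i) _.
  count-nonMultiples-block : ∀ o → p ∣ o → length (filter nonMultiple? (applyUpTo (o +_) p)) ≡ r
  count-nonMultiples-block o p∣o = begin
      length (filter nonMultiple? (applyUpTo (o +_) p))
    ≡⟨ cong (length ∘ filter nonMultiple?) (applyUpTo-∷ʳ (o +_) r) ⟨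
      length (filter nonMultiple? (applyUpTo (o +_) r ∷ʳ (o + r)))
    ≡⟨ cong length (filter-++ nonMultiple? (applyUpTo (o +_) r) [ o + r ]) ⟩
      length (filter nonMultiple? (applyUpTo (o +_) r) ++ filter nonMultiple? [ o + r ])
    ≡⟨ cong₂ (λ xs ys → length (xs ++ ys))
         (filter-all nonMultiple? (applyUpTo⁺₁ (o +_) r p∤below))
         (filter-reject nonMultiple? (λ p∤ → p∤ p∣last)) ⟩
      length (applyUpTo (o +_) r ++ [])
    ≡⟨ cong length (++-identityʳ (applyUpTo (o +_) r)) ⟩
      length (applyUpTo (o +_) r)
    ≡⟨ length-applyUpTo (o +_) r ⟩
      r
    ∎
    where
    open ≡-Reasoning
    p∣last : p ∣ suc (o + r)
    p∣last = subst (p ∣_) (+-suc o r) (∣m∣n⇒∣m+n p∣o ∣-refl)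
    p∤below : ∀ {i} → i < r → p ∤ suc (o + i)
    p∤below {i} i<r p∣ = <⇒≱ (s≤s i<r) (∣⇒≤ (∣m+n∣m⇒∣n (subst (p ∣_) (sym (+-suc o i)) p∣) p∣o))

  count-nonMultiples : ∀ q o → p ∣ o → length (filter nonMultiple? (applyUpTo (o +_) (q * p))) ≡ q * r
  count-nonMultiples zero    o p∣o = refl
  count-nonMultiples (suc q) o p∣o = begin
      length (filter nonMultiple? (applyUpTo (o +_) (p + q * p)))
    ≡⟨ cong (length ∘ filter nonMultiple?) (applyUpTo-++ (o +_) p (q * p)) ⟩
      length (filter nonMultiple? (block ++ applyUpTo (λ i → o + (p + i)) (q * p)))
    ≡⟨ cong (length ∘ filter nonMultiple? ∘ (block ++_)) (applyUpTo-cong (λ i → sym (+-assoc o p i)) (q * p)) ⟩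
      length (filter nonMultiple? (block ++ rest))
    ≡⟨ cong length (filter-++ nonMultiple? block rest) ⟩
      length (filter nonMultiple? block ++ filter nonMultiple? rest)
    ≡⟨ length-++ (filter nonMultiple? block) ⟩
      length (filter nonMultiple? block) + length (filter nonMultiple? rest)
    ≡⟨ cong₂ _+_ (count-nonMultiples-block o p∣o) (count-nonMultiples q (o + p) (∣m∣n⇒∣m+n p∣o ∣-refl)) ⟩
      r + q * r
    ∎
    where
    open ≡-Reasoning
    block = applyUpTo (o +_) p
    rest  = applyUpTo ((o + p) +_) (q * p)

  φ[p^[k+1]]≡p^k*[p-1] : ∀ k → φ (p ^ suc k) ≡ p ^ k * r
  φ[p^[k+1]]≡p^k*[p-1] k = begin
      φ (p ^ suc k)
    ≡⟨ cong length (filter-≐ (λ i → gcd (suc i) (p ^ suc k) ≟ 1) nonMultiple?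
                               (gcd≡1⇒p∤ , p∤⇒gcd≡1) (upTo (p ^ suc k))) ⟩
      length (filter nonMultiple? (upTo (p * p ^ k)))
    ≡⟨ cong (length ∘ filter nonMultiple? ∘ upTo) (*-comm p (p ^ k)) ⟩
      length (filter nonMultiple? (applyUpTo (0 +_) (p ^ k * p)))
    ≡⟨ count-nonMultiples (p ^ k) 0 (p ∣0) ⟩
      p ^ k * r
    ∎
    where
    open ≡-Reasoning
    gcd≡1⇒p∤ : ∀ {i} → gcd (suc i) (p ^ suc k) ≡ 1 → p ∤ suc i
    gcd≡1⇒p∤ gcd≡1 p∣ = <⇒≢ (nonTrivial⇒n>1 p {{prime⇒nonTrivial pr}})
      (sym (∣1⇒≡1 (subst (p ∣_) gcd≡1 (gcd-greatest p∣ (m∣m*n (p ^ k))))))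
    p∤⇒gcd≡1 : ∀ {i} → p ∤ suc i → gcd (suc i) (p ^ suc k) ≡ 1
    p∤⇒gcd≡1 p∤ = coprime⇒gcd≡1 (coprime-^ (prime∤⇒coprime pr p∤) (suc k))

euler : ∀ {p k n x} → Prime p → 1 ≤ k → φ (p ^ k) ∣ n → p ∤ x → x ^ n ≡1-mod p ^ k
euler {suc r} {suc k} {n} {x} pr _ (divides q n≡q*φ) p∤x =
  subst (_≡1-mod suc r ^ suc k) x^[p^k*r]^q≡x^n (≡1-mod-^ (euler-prime-power pr p∤x k) q)
  where
  x^[p^k*r]^q≡x^n : (x ^ (suc r ^ k * r)) ^ q ≡ x ^ n
  x^[p^k*r]^q≡x^n = trans (^-*-assoc x (suc r ^ k * r) q)
    (cong (x ^_) (sym (trans n≡q*φ (trans (cong (q *_) (φ[p^[k+1]]≡p^k*[p-1] pr k)) (*-comm q _)))))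

φ-divisor-degree≤ : ∀ {n p k} → IsφDivisorOfDegree n p k → k ≤ n
φ-divisor-degree≤ {n} {suc r} {suc k} (pr , (_ , divides q n≡q*φ , 3≤p^k) , maximal) with q
... | zero   = ⊥-elim (<⇒≱ (n<1+n (suc k)) (maximal (suc (suc k)) (z<s , φ∣n , 3≤p^[k+1])))
  where
  φ∣n : φ (suc r ^ suc (suc k)) ∣ n
  φ∣n = subst (_ ∣_) (sym n≡q*φ) (_ ∣0)
  3≤p^[k+1] : 3 ≤ suc r ^ suc (suc k)
  3≤p^[k+1] = ≤-trans 3≤p^k (m≤n*m (suc r ^ suc k) (suc r))
... | suc q′ = begin
    suc k                        ≤⟨ n<[1+m]^n 0<r k ⟩
    suc r ^ k                    ≤⟨ m≤m*n (suc r ^ k) r {{>-nonZero 0<r}} ⟩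
    suc r ^ k * r                ≤⟨ m≤m+n (suc r ^ k * r) (q′ * (suc r ^ k * r)) ⟩
    suc q′ * (suc r ^ k * r)     ≡⟨ cong (suc q′ *_) (φ[p^[k+1]]≡p^k*[p-1] pr k) ⟨
    suc q′ * φ (suc r ^ suc k)   ≡⟨ n≡q*φ ⟨
    n                            ∎
  where
  open ≤-Reasoning
  0<r : 0 < r
  0<r = ≤-pred (nonTrivial⇒n>1 (suc r) {{prime⇒nonTrivial pr}})

-- Cancelling the primes of c

sumPow-scale : ∀ {m} n p (x y : Fin m → ℕ) → (∀ i → x i ≡ y i * p) → sumPow x n ≡ sumPow y n * p ^ n
sumPow-scale {zero}  n p x y x≡yp = refl
sumPow-scale {suc m} n p x y x≡yp = begin
    x zero ^ n + sumPow (x ∘ suc) n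
  ≡⟨ cong₂ _+_ (cong (_^ n) (x≡yp zero)) (sumPow-scale n p (x ∘ suc) (y ∘ suc) (x≡yp ∘ suc)) ⟩
    (y zero * p) ^ n + sumPow (y ∘ suc) n * p ^ n
  ≡⟨ cong (_+ sumPow (y ∘ suc) n * p ^ n) (^-distrib-* (y zero) p n) ⟩
    y zero ^ n * p ^ n + sumPow (y ∘ suc) n * p ^ n
  ≡⟨ *-distribʳ-+ (p ^ n) (y zero ^ n) _ ⟨
    sumPow y n * p ^ n
  ∎
  where open ≡-Reasoning

m≤sumPow : ∀ {m} n (x : Fin m → ℕ) → (∀ i → 1 ≤ x i) → m ≤ sumPow x n
m≤sumPow {zero}  n x x≥1 = z≤n
m≤sumPow {suc m} n x x≥1 =
  +-mono-≤ (m^n>0 (x zero) {{>-nonZero (x≥1 zero)}} n) (m≤sumPow n (x ∘ suc) (x≥1 ∘ suc))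

record NaturalSolution (m n b c : ℕ) : Set where
  constructor solution
  field
    x        : Fin m → ℕ
    positive : ∀ i → 1 ≤ x i
    equation : sumPow x n ≡ b * c ^ n

module _ (p : ℕ) where

  nonMultiples : ∀ {m} → (Fin m → ℕ) → ℕ
  nonMultiples x = count (p ∤?_) (tabulate x)

  nonMultiples≡0 : ∀ {m} (x : Fin m → ℕ) → nonMultiples x ≡ 0 → ∀ i → p ∣ x i
  nonMultiples≡0 {suc _} x #≡0 i with p ∣? x zero | i
  ... | yes p∣x₀ | zero  = p∣x₀
  ... | yes _    | suc i = nonMultiples≡0 (x ∘ suc) #≡0 i

  module _ {n M} (M∣p^n : M ∣ p ^ n) (nonMultiple^n : ∀ {y} → p ∤ y → y ^ n ≡1-mod M) where

    sumPow≡nonMultiples-mod : ∀ {m} (x : Fin m → ℕ) → ∃ λ T → sumPow x n ≡ nonMultiples x + T * M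
    sumPow≡nonMultiples-mod {zero}  x = 0 , refl
    sumPow≡nonMultiples-mod {suc m} x with sumPow≡nonMultiples-mod (x ∘ suc) | p ∣? x zero
    ... | T , rest≡ | yes p∣x₀ =
      let divides t x₀^n≡ = ∣-trans M∣p^n (^-monoˡ-∣ n p∣x₀)
      in t + T , (begin
        x zero ^ n + sumPow (x ∘ suc) n
      ≡⟨ cong₂ _+_ x₀^n≡ rest≡ ⟩
        t * M + (nonMultiples (x ∘ suc) + T * M)
      ≡⟨ solve 4 (λ t M c T → t :* M :+ (c :+ T :* M) := c :+ (t :+ T) :* M) refl t M (nonMultiples (x ∘ suc)) T ⟩
        nonMultiples (x ∘ suc) + (t + T) * M
      ∎)
      where open ≡-Reasoning
    ... | T , rest≡ | no p∤x₀ =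
      let t , x₀^n≡ = nonMultiple^n p∤x₀
      in t + T , (begin
        x zero ^ n + sumPow (x ∘ suc) n
      ≡⟨ cong₂ _+_ x₀^n≡ rest≡ ⟩
        1 + t * M + (nonMultiples (x ∘ suc) + T * M)
      ≡⟨ solve 4 (λ t M c T → con 1 :+ t :* M :+ (c :+ T :* M) := con 1 :+ c :+ (t :+ T) :* M) refl t M (nonMultiples (x ∘ suc)) T ⟩
        suc (nonMultiples (x ∘ suc)) + (t + T) * M
      ∎)
      where open ≡-Reasoning

    cancel-common-factor : ∀ {m b c} .{{_ : NonZero p}} → m < M →
      NaturalSolution m n b (p * c) → NaturalSolution m n b c
    cancel-common-factor {m} {b} {c} m<M (solution x x≥1 sumPow≡) = solution y y≥1 sumPow-y≡
      where
      instance _ = m^n≢0 p n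
      T = proj₁ (sumPow≡nonMultiples-mod x)
      M∣rhs : M ∣ b * (p * c) ^ n
      M∣rhs = ∣n⇒∣m*n b (subst (M ∣_) (sym (^-distrib-* p c n)) (∣m⇒∣m*n (c ^ n) M∣p^n))
      M∣nonMultiples : M ∣ nonMultiples x
      M∣nonMultiples = ∣m+n∣m⇒∣n
        (subst (M ∣_) (trans (sym sumPow≡) (trans (proj₂ (sumPow≡nonMultiples-mod x)) (+-comm (nonMultiples x) (T * M)))) M∣rhs)
        (n∣m*n T)
      p∣x : ∀ i → p ∣ x i
      p∣x = nonMultiples≡0 x (<∧∣⇒≡0 (≤-<-trans (count≤n (p ∤?_) (tabulate x)) m<M) M∣nonMultiples)
      y : Fin m → ℕ
      y i = quotient (p∣x i)
      y≥1 : ∀ i → 1 ≤ y i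
      y≥1 i = >-nonZero⁻¹ (y i) {{quotient≢0 (p∣x i) {{>-nonZero (x≥1 i)}}}}
      sumPow-y≡ : sumPow y n ≡ b * c ^ n
      sumPow-y≡ = *-cancelʳ-≡ (sumPow y n) (b * c ^ n) (p ^ n) (begin
          sumPow y n * p ^ n   ≡⟨ sumPow-scale n p x y (λ i → m∣n⇒n≡quotient*m (p∣x i)) ⟨
          sumPow x n           ≡⟨ sumPow≡ ⟩
          b * (p * c) ^ n      ≡⟨ cong (b *_) (^-distrib-* p c n) ⟩
          b * (p ^ n * c ^ n)  ≡⟨ solve 3 (λ b P C → b :* (P :* C) := b :* C :* P) refl b (p ^ n) (c ^ n) ⟩
          b * c ^ n * p ^ n    ∎)
        where open ≡-Reasoning

StandardPrime : (m n p : ℕ) → Set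
StandardPrime m n p = ∃ λ k → IsφDivisorOfDegree n p k × m < p ^ k

cancel-standard-prime : ∀ {m n b c p} → StandardPrime m n p →
  NaturalSolution m n b (p * c) → NaturalSolution m n b c
cancel-standard-prime {p = p} (k , isd@(pr , (1≤k , φ∣n , _) , _) , m<p^k) =
  cancel-common-factor p (^-monoʳ-∣ p (φ-divisor-degree≤ isd)) (euler pr 1≤k φ∣n) {{prime⇒nonZero pr}} m<p^k

cancel-standard-prime-power : ∀ {m n b c p} → StandardPrime m n p → ∀ e →
  NaturalSolution m n b (p ^ e * c) → NaturalSolution m n b c
cancel-standard-prime-power {m} {n} {b} {c} cp zero =
  subst (NaturalSolution m n b) (*-identityˡ c)
cancel-standard-prime-power {m} {n} {b} {c} {p} cp (suc e) =
  cancel-standard-prime-power cp e ∘ cancel-standard-prime cp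
    ∘ subst (NaturalSolution m n b) (*-assoc p (p ^ e) c)

cancel-factorisation : ∀ {m n b} fs → All (StandardPrime m n ∘ proj₁) fs →
  NaturalSolution m n b (factValue fs) → NaturalSolution m n b 1
cancel-factorisation []             []         = id
cancel-factorisation ((p , e) ∷ fs) (cp ∷ cps) =
  cancel-factorisation fs cps ∘ cancel-standard-prime-power cp e

no-solution-for-b<m : ∀ {m n b} → b < m → NaturalSolution m n b 1 → ⊥
no-solution-for-b<m {m} {n} {b} b<m (solution x x≥1 sumPow≡) = <⇒≱ b<m (begin
  m           ≤⟨ m≤sumPow n x x≥1 ⟩
  sumPow x n  ≡⟨ sumPow≡ ⟩
  b * 1 ^ n   ≡⟨ cong (b *_) (^-zeroˡ n) ⟩
  b * 1       ≡⟨ *-identityʳ b ⟩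
  b           ∎)
  where open ≤-Reasoning

theorem11 : (m n b c : ℕ) → Standard m n b c → b < m →
    (x : Fin m → ℕ) → (∀ i → 1 ≤ x i) → sumPow x n ≡ b * c ^ n → ⊥
theorem11 m n b c (_ , _ , fs , _ , _ , c≡ , primes) b<m x x≥1 sumPow≡ =
  no-solution-for-b<m b<m
    (cancel-factorisation fs (All.map proj₂ primes)
      (solution x x≥1 (subst (λ c → sumPow x n ≡ b * c ^ n) c≡ sumPow≡)))
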